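{- Let $c_3>0$ be a constant with the following property: for every finite linearly ordered set $V$ of size $n$, all pairwise disjoint $A_1,A_2,A_3\subseteq V$ and every $\varepsilon>0$, if the number of $(A_1,A_2,A_3)$-sequences is at most $c_3\varepsilon^3n^3$, then there is $S\subseteq V$ with $|S|\leq\varepsilon n$ intersecting every $(A_1,A_2,A_3)$-sequence. Let $c=c_3/64$. Let $G$ be an $n$-vertex ordered graph with a vertex partition $V(G)=X_1\cup\dots\cup X_m$ such that $X_1,\dots,X_m$ are cliques and $G[X_i\cup X_j]$ is induced $D$-free for all $i<j$. Let $\gamma>0$ and suppose $G$ has at most $c\gamma^6 n^3/m^{15}$ induced copies of $D$. Then there is a set $S\subseteq V(G)$ with $|S|\leq\gamma n$ and a partition of $V(G)\setminus S$ into intervals $I_1,\dots,I_t$ with $t\leq 2m^3$ such that for every $1\leq j\leq t$, $G[I_j]$ is a disjoint union of cliques, each of the form $I_j\cap\left(\bigcup_{i\in M}X_i\right)$ for some $M\subseteq[m]$.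
   Context: An ordered graph is a graph with a linear order on its vertex set. $D$ is the ordered graph with vertices $x<y<z$ and edges $\{x,y\},\{x,z\}$; an induced copy of $D$ is a triple $u<v<w$ with $\{u,v\},\{u,w\}$ edges and $\{v,w\}$ a non-edge; induced $D$-free means containing no such triple. For an ordered set $V$ and disjoint $A_1,\dots,A_k\subseteq V$, an $(A_1,\dots,A_k)$-sequence is a sequence $v_1<\dots<v_k$ of elements of $V$ with $v_i\in A_i$. An interval of an ordered set $U$ is a set of the form $\{x\in U: a\leq x\leq b\}$. A graph is a disjoint union of cliques if its vertex set partitions into cliques with no edges between them.
   Formalization: The constant c₃, the parameter γ and the ε in the property assumed of c₃ are all taken to be rational. -}

module Defs where

open import Data.Nat as ℕ using (ℕ; zero; suc; _<ᵇ_)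
open import Data.Integer using (+_)
open import Data.Rational as ℚ using (ℚ; _/_; _*_; _≤_; _<_; 0ℚ; 1ℚ)
open import Data.Bool using (Bool; true; false; _∧_; not; if_then_else_)
open import Data.Fin using (Fin; toℕ)
open import Data.Fin.Subset using (Subset; _∈_; _∉_)
open import Data.Vec using (lookup)
open import Data.List using (List; map; allFin)
open import Data.Nat.ListAction using (sum)
open import Data.Product using (Σ; ∃; _×_; _,_)
open import Data.Sum using (_⊎_)
open import Relation.Binary.PropositionalEquality using (_≡_)
open import Relation.Nullary using (¬_)

ℕ→ℚ : ℕ → ℚ
ℕ→ℚ k = + k / 1

_^ℚ_ : ℚ → ℕ → ℚ
q ^ℚ zero = 1ℚ
q ^ℚ suc k = q * (q ^ℚ k)

_<F_ : ∀ {N} → Fin N → Fin N → Bool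
u <F v = toℕ u <ᵇ toℕ v

count3 : ∀ {N} → (Fin N → Fin N → Fin N → Bool) → ℕ
count3 {N} P =
  sum (map (λ u → sum (map (λ v → sum (map (λ w → if P u v w then 1 else 0)
    (allFin N))) (allFin N))) (allFin N))

isSeq : ∀ {N} → Subset N → Subset N → Subset N → Fin N → Fin N → Fin N → Bool
isSeq A₁ A₂ A₃ u v w =
  lookup A₁ u ∧ lookup A₂ v ∧ lookup A₃ w ∧ (u <F v) ∧ (v <F w)

Disjoint : ∀ {N} → Subset N → Subset N → Set
Disjoint A B = ∀ x → ¬ (x ∈ A × x ∈ B)

Hits : ∀ {N} → Subset N → Subset N → Subset N → Subset N → Set
Hits S A₁ A₂ A₃ =
  ∀ u v w → isSeq A₁ A₂ A₃ u v w ≡ true → u ∈ S ⊎ v ∈ S ⊎ w ∈ S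

-- Property of the constant c₃ (vertex set of size N is taken to be Fin N
-- with its natural order; every finite linear order is isomorphic to one).
C3Property : ℚ → Set
C3Property c₃ =
  ∀ (N : ℕ) (A₁ A₂ A₃ : Subset N) →
  Disjoint A₁ A₂ → Disjoint A₁ A₃ → Disjoint A₂ A₃ →
  ∀ (ε : ℚ) → 0ℚ < ε →
  ℕ→ℚ (count3 (isSeq A₁ A₂ A₃)) ≤ c₃ * (ε ^ℚ 3) * (ℕ→ℚ N ^ℚ 3) →
  Σ (Subset N) λ S → (ℕ→ℚ (Data.Fin.Subset.∣ S ∣) ≤ ε * ℕ→ℚ N) × Hits S A₁ A₂ A₃

-- An ordered graph on vertex set Fin n (natural order); adjacency as a
-- Boolean relation, symmetric and loopless.
record OGraph (n : ℕ) : Set where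
  field
    E     : Fin n → Fin n → Bool
    sym   : ∀ u v → E u v ≡ E v u
    irrfl : ∀ u → E u u ≡ false
open OGraph public

isD : ∀ {n} → OGraph n → Fin n → Fin n → Fin n → Bool
isD G u v w = (u <F v) ∧ (v <F w) ∧ E G u v ∧ E G u w ∧ not (E G v w)

numD : ∀ {n} → OGraph n → ℕ
numD G = count3 (isD G)

IsClique : ∀ {n} → OGraph n → (Fin n → Set) → Set
IsClique G W = ∀ u v → W u → W v → ¬ (u ≡ v) → E G u v ≡ true

IsInterval : ∀ {n} → Subset n → Subset n → Set
IsInterval {n} U I = Σ (Fin n) λ a → Σ (Fin n) λ b →
  ∀ x → (x ∈ I → x ∈ U × toℕ a ℕ.≤ toℕ x × toℕ x ℕ.≤ toℕ b)
      × (x ∈ U × toℕ a ℕ.≤ toℕ x × toℕ x ℕ.≤ toℕ b → x ∈ I)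

-- G[W] is a disjoint union of cliques, each of the form
-- W ∩ ⋃_{i ∈ M} X_i  (X_i = part ⁻¹ i) for some M ⊆ [m].
DUCliquesOfForm : ∀ {n m} → OGraph n → (Fin n → Fin m) → Subset n → Set
DUCliquesOfForm {n} {m} G part W =
  Σ ℕ λ k → Σ (Fin k → Subset n) λ C →
    (∀ l x → x ∈ C l → x ∈ W) ×
    (∀ x → x ∈ W → ∃ λ l → x ∈ C l) ×
    (∀ l → ∃ λ x → x ∈ C l) ×
    (∀ l l′ x → x ∈ C l → x ∈ C l′ → l ≡ l′) ×
    (∀ l → IsClique G (λ x → x ∈ C l)) ×
    (∀ l l′ u v → ¬ (l ≡ l′) → u ∈ C l → v ∈ C l′ → E G u v ≡ false) ×
    (∀ l → Σ (Subset m) λ M →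
       ∀ x → (x ∈ C l → x ∈ W × part x ∈ M) × (x ∈ W × part x ∈ M → x ∈ C l))

-- For two parts X_i, X_j whose union is induced D-free there is a threshold β: cross pairs
-- below β are non-adjacent and cross pairs from β on are adjacent. Cutting the vertex order at
-- all m² thresholds gives at most m² + 1 layers, and inside a layer adjacency between distinct
-- parts depends only on the parts. A layer is then a disjoint union of cliques of the required
-- form unless three parts a, b, c span an induced path a–b–c; in that case every increasing triple
-- of the layer with first vertex in X_b and the others in X_a and X_c is an induced D, so there
-- are few of them, and the property of c₃ with ε = γ / ((m² + 1) m³) gives at most εn vertices
-- meeting them all. Delete the union S of these hitting sets and cut each layer once more at the
-- first remaining vertex of each part. Inside one of the resulting (at most 2m³) intervals, an
-- induced path a–b–c would give such a triple missed by S, starting at that first vertex of X_b.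

module Submission where

open import Defs renaming (sym to E-sym)
open import Data.Nat as ℕ using (ℕ; zero; suc; _≤_; _<_; z≤n; s≤s)
import Data.Nat.Properties as ℕP
open import Data.Integer as ℤ using (+_)
import Data.Integer.Properties as ℤP
open import Data.Rational as ℚ using (ℚ; _/_; _*_; _+_; 0ℚ; 1ℚ) renaming (_≤_ to _≤ℚ_; _<_ to _<ℚ_)
import Data.Rational.Properties as ℚP
open import Data.Rational.Unnormalised as ℚᵘ using (mkℚᵘ; *≡*; *≤*)
import Data.Rational.Unnormalised.Properties as ℚᵘP
open import Data.Bool using (Bool; true; false; _∧_; not; if_then_else_)
import Data.Bool.Properties as BP
open import Data.Fin as Fin using (Fin; toℕ)
import Data.Fin.Properties as FP
open import Data.Fin.Subset using (Subset; _∈_; _∉_; ∣_∣; _∪_; ∁; ⊥; ⊤)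
import Data.Fin.Subset.Properties as SP
open import Data.Vec using ([]; _∷_; tabulate; lookup)
import Data.Vec.Properties as VP
open import Data.List using ([]; _∷_; map; allFin)
open import Data.Nat.ListAction using (sum)
open import Data.Product using (Σ; ∃; _×_; _,_; proj₁; proj₂; uncurry; map₂)
open import Data.Sum using (_⊎_; inj₁; inj₂; [_,_]′; swap)
open import Data.Empty using (⊥-elim)
open import Relation.Nullary using (¬_; Dec; does; yes; no; ¬?)
open import Relation.Nullary.Decidable using (_×-dec_; _⊎-dec_; _→-dec_; dec-true; dec-false)
open import Relation.Binary.Definitions using (Tri; tri<; tri≈; tri>)
open import Relation.Binary.PropositionalEquality
open import Function using (_∘_; const; case_of_)
open import Function.Bundles using (Equivalence)

-- Decidable subsets, enumerations and extremal elements of Fin n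

∈⇒lookup≡true : ∀ {n} {x : Fin n} {p : Subset n} → x ∈ p → lookup p x ≡ true
∈⇒lookup≡true = VP.[]=⇒lookup

lookup≡true⇒∈ : ∀ {n} {x : Fin n} {p : Subset n} → lookup p x ≡ true → x ∈ p
lookup≡true⇒∈ {x = x} {p} = VP.lookup⇒[]= x p

module _ {n} {P : Fin n → Set} (P? : ∀ x → Dec (P x)) where

  ⟦_⟧ : Subset n
  ⟦_⟧ = tabulate (does ∘ P?)

  ∈⟦⟧⁺ : ∀ {x} → P x → x ∈ ⟦_⟧
  ∈⟦⟧⁺ {x} px = lookup≡true⇒∈ (trans (VP.lookup∘tabulate _ x) (dec-true (P? x) px))

  ∈⟦⟧⁻ : ∀ {x} → x ∈ ⟦_⟧ → P x
  ∈⟦⟧⁻ {x} x∈ with P? x | trans (sym (VP.lookup∘tabulate (does ∘ P?) x)) (∈⇒lookup≡true x∈)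
  ... | yes px | _ = px

record Enumeration {n} (P : Fin n → Set) : Set where
  field
    size            : ℕ
    elem            : Fin size → Fin n
    elem-sat        : ∀ l → P (elem l)
    elem-injective  : ∀ l l′ → elem l ≡ elem l′ → l ≡ l′
    elem-surjective : ∀ x → P x → ∃ λ l → elem l ≡ x
    size≤n          : size ≤ n

enumerate : ∀ {n} {P : Fin n → Set} → (∀ x → Dec (P x)) → Enumeration P
enumerate {zero} P? = record
  { size = 0 ; elem = λ () ; elem-sat = λ () ; elem-injective = λ ()
  ; elem-surjective = λ () ; size≤n = z≤n }
enumerate {suc n} {P} P? = extend (enumerate (P? ∘ Fin.suc)) (P? Fin.zero)
  where
  extend : Enumeration (P ∘ Fin.suc) → Dec (P Fin.zero) → Enumeration P
  extend e (yes p0) = record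
    { size = suc size ; elem = elem′ ; elem-sat = sat′ ; elem-injective = inj′
    ; elem-surjective = surj′ ; size≤n = s≤s size≤n }
    where
    open Enumeration e
    elem′ : Fin (suc size) → Fin (suc n)
    elem′ Fin.zero = Fin.zero
    elem′ (Fin.suc l) = Fin.suc (elem l)
    sat′ : ∀ l → P (elem′ l)
    sat′ Fin.zero = p0
    sat′ (Fin.suc l) = elem-sat l
    inj′ : ∀ l l′ → elem′ l ≡ elem′ l′ → l ≡ l′
    inj′ Fin.zero Fin.zero _ = refl
    inj′ (Fin.suc l) (Fin.suc l′) eq = cong Fin.suc (elem-injective l l′ (FP.suc-injective eq))
    surj′ : ∀ x → P x → ∃ λ l → elem′ l ≡ x
    surj′ Fin.zero _ = Fin.zero , refl
    surj′ (Fin.suc x) px with elem-surjective x px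
    ... | l , eq = Fin.suc l , cong Fin.suc eq
  extend e (no ¬p0) = record
    { size = size ; elem = Fin.suc ∘ elem ; elem-sat = elem-sat
    ; elem-injective = λ l l′ eq → elem-injective l l′ (FP.suc-injective eq)
    ; elem-surjective = surj′ ; size≤n = ℕP.m≤n⇒m≤1+n size≤n }
    where
    open Enumeration e
    surj′ : ∀ x → P x → ∃ λ l → Fin.suc (elem l) ≡ x
    surj′ Fin.zero p0 = ⊥-elim (¬p0 p0)
    surj′ (Fin.suc x) px with elem-surjective x px
    ... | l , eq = l , cong Fin.suc eq

Least Greatest : ∀ {n} → (Fin n → Set) → Set
Least P = ∃ λ a → P a × (∀ y → P y → toℕ a ≤ toℕ y)
Greatest P = ∃ λ b → P b × (∀ y → P y → toℕ y ≤ toℕ b)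

least? : ∀ {n} {P : Fin n → Set} → (∀ x → Dec (P x)) → Least P ⊎ (∀ y → ¬ P y)
least? {zero} P? = inj₂ λ ()
least? {suc n} {P} P? with P? Fin.zero | least? (P? ∘ Fin.suc)
... | yes p0 | _ = inj₁ (Fin.zero , p0 , λ _ _ → z≤n)
... | no ¬p0 | inj₁ (a , pa , a≤) = inj₁ (Fin.suc a , pa , λ
  { Fin.zero p0 → ⊥-elim (¬p0 p0) ; (Fin.suc y) py → s≤s (a≤ y py) })
... | no ¬p0 | inj₂ none = inj₂ λ { Fin.zero → ¬p0 ; (Fin.suc y) → none y }

greatest? : ∀ {n} {P : Fin n → Set} → (∀ x → Dec (P x)) → Greatest P ⊎ (∀ y → ¬ P y)
greatest? {zero} P? = inj₂ λ ()
greatest? {suc n} {P} P? with greatest? (P? ∘ Fin.suc) | P? Fin.zero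
... | inj₁ (b , pb , ≤b) | _ = inj₁ (Fin.suc b , pb , λ
  { Fin.zero _ → z≤n ; (Fin.suc y) py → s≤s (≤b y py) })
... | inj₂ none | yes p0 = inj₁ (Fin.zero , p0 , λ
  { Fin.zero _ → z≤n ; (Fin.suc y) py → ⊥-elim (none y py) })
... | inj₂ none | no ¬p0 = inj₂ λ { Fin.zero → ¬p0 ; (Fin.suc y) → none y }

least : ∀ {n} {P : Fin n → Set} → (∀ x → Dec (P x)) → ∃ P → Least P
least P? (x , px) with least? P?
... | inj₁ l = l
... | inj₂ none = ⊥-elim (none x px)

greatest : ∀ {n} {P : Fin n → Set} → (∀ x → Dec (P x)) → ∃ P → Greatest P
greatest P? (x , px) with greatest? P?
... | inj₁ g = g
... | inj₂ none = ⊥-elim (none x px)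

-- Cutting a linear order into intervals

#cuts≤ : ∀ {k} → (Fin k → ℕ) → ℕ → ℕ
#cuts≤ {zero} c v = 0
#cuts≤ {suc k} c v with c Fin.zero ℕ.≤? v
... | yes _ = suc (#cuts≤ (c ∘ Fin.suc) v)
... | no _ = #cuts≤ (c ∘ Fin.suc) v

#cuts≤≤k : ∀ {k} (c : Fin k → ℕ) v → #cuts≤ c v ≤ k
#cuts≤≤k {zero} c v = z≤n
#cuts≤≤k {suc k} c v with c Fin.zero ℕ.≤? v
... | yes _ = s≤s (#cuts≤≤k (c ∘ Fin.suc) v)
... | no _ = ℕP.m≤n⇒m≤1+n (#cuts≤≤k (c ∘ Fin.suc) v)

#cuts≤-mono : ∀ {k} (c : Fin k → ℕ) {v w} → v ≤ w → #cuts≤ c v ≤ #cuts≤ c w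
#cuts≤-mono {zero} c v≤w = z≤n
#cuts≤-mono {suc k} c {v} {w} v≤w with c Fin.zero ℕ.≤? v | c Fin.zero ℕ.≤? w
... | yes _ | yes _ = s≤s (#cuts≤-mono (c ∘ Fin.suc) v≤w)
... | yes c≤v | no c≰w = ⊥-elim (c≰w (ℕP.≤-trans c≤v v≤w))
... | no _ | yes _ = ℕP.m≤n⇒m≤1+n (#cuts≤-mono (c ∘ Fin.suc) v≤w)
... | no _ | no _ = #cuts≤-mono (c ∘ Fin.suc) v≤w

#cuts≤-strict : ∀ {k} (c : Fin k → ℕ) {v w} q → v < c q → c q ≤ w → #cuts≤ c v < #cuts≤ c w
#cuts≤-strict {suc k} c {v} {w} Fin.zero v<c c≤w with c Fin.zero ℕ.≤? v | c Fin.zero ℕ.≤? w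
... | yes c≤v | _ = ⊥-elim (ℕP.<⇒≱ v<c c≤v)
... | no _ | no c≰w = ⊥-elim (c≰w c≤w)
... | no _ | yes _ = s≤s (#cuts≤-mono (c ∘ Fin.suc) (ℕP.<⇒≤ (ℕP.<-≤-trans v<c c≤w)))
#cuts≤-strict {suc k} c {v} {w} (Fin.suc q) v<c c≤w with c Fin.zero ℕ.≤? v | c Fin.zero ℕ.≤? w
... | yes _ | yes _ = s≤s (#cuts≤-strict (c ∘ Fin.suc) q v<c c≤w)
... | yes c≤v | no c≰w = ⊥-elim (c≰w (ℕP.≤-trans c≤v (ℕP.<⇒≤ (ℕP.<-≤-trans v<c c≤w))))
... | no _ | yes _ = ℕP.m≤n⇒m≤1+n (#cuts≤-strict (c ∘ Fin.suc) q v<c c≤w)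
... | no _ | no _ = #cuts≤-strict (c ∘ Fin.suc) q v<c c≤w

#cuts≤-cong : ∀ {k} (c : Fin k → ℕ) {v w} →
  (∀ q → c q ≤ v → c q ≤ w) → (∀ q → c q ≤ w → c q ≤ v) → #cuts≤ c v ≡ #cuts≤ c w
#cuts≤-cong {zero} c _ _ = refl
#cuts≤-cong {suc k} c {v} {w} v⇒w w⇒v with c Fin.zero ℕ.≤? v | c Fin.zero ℕ.≤? w
... | yes _ | yes _ = cong suc (#cuts≤-cong (c ∘ Fin.suc) (v⇒w ∘ Fin.suc) (w⇒v ∘ Fin.suc))
... | yes c≤v | no c≰w = ⊥-elim (c≰w (v⇒w Fin.zero c≤v))
... | no c≰v | yes c≤w = ⊥-elim (c≰v (w⇒v Fin.zero c≤w))
... | no _ | no _ = #cuts≤-cong (c ∘ Fin.suc) (v⇒w ∘ Fin.suc) (w⇒v ∘ Fin.suc)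

#cuts≤-≡⇒cut≤ : ∀ {k} (c : Fin k → ℕ) {v w} → #cuts≤ c v ≡ #cuts≤ c w → ∀ q → c q ≤ v → c q ≤ w
#cuts≤-≡⇒cut≤ c {v} {w} eq q c≤v with c q ℕ.≤? w
... | yes c≤w = c≤w
... | no c≰w = ⊥-elim (ℕP.<-irrefl (sym eq) (#cuts≤-strict c q (ℕP.≰⇒> c≰w) c≤v))

#cuts≤-reflects-cut≤ : ∀ {k} (c : Fin k → ℕ) q {v} → #cuts≤ c (c q) ≤ #cuts≤ c v → c q ≤ v
#cuts≤-reflects-cut≤ c q {v} le with c q ℕ.≤? v
... | yes c≤v = c≤v
... | no c≰v = ⊥-elim (ℕP.<⇒≱ (#cuts≤-strict c q (ℕP.≰⇒> c≰v) ℕP.≤-refl) le)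

record IntervalPartition {n} (S : Subset n) {k} (c : Fin k → ℕ) : Set where
  field
    t        : ℕ
    I        : Fin t → Subset n
    t≤1+k    : t ≤ suc k
    interval : ∀ j → IsInterval (∁ S) (I j)
    nonempty : ∀ j → ∃ λ x → x ∈ I j
    disjoint : ∀ j j′ x → x ∈ I j → x ∈ I j′ → j ≡ j′
    covers   : ∀ x → x ∉ S → ∃ λ j → x ∈ I j
    avoids   : ∀ j x → x ∈ I j → x ∉ S
    uncut    : ∀ j x y → x ∈ I j → y ∈ I j → ∀ q → c q ≤ toℕ x → c q ≤ toℕ y

-- The intervals are the nonempty fibres of x ↦ #cuts≤ c x on the complement of S.
intervalPartition : ∀ {n} (S : Subset n) {k} (c : Fin k → ℕ) → IntervalPartition S c
intervalPartition {n} S {k} c = record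
  { t = size ; I = I ; t≤1+k = size≤n ; interval = interval ; nonempty = nonempty
  ; disjoint = disjoint ; covers = covers ; avoids = λ j x → proj₁ ∘ ∈I⁻
  ; uncut = uncut }
  where
  key : Fin n → ℕ
  key x = #cuts≤ c (toℕ x)
  Fibre : ℕ → Fin n → Set
  Fibre v x = x ∉ S × key x ≡ v
  Fibre? : ∀ v x → Dec (Fibre v x)
  Fibre? v x = ¬? (x SP.∈? S) ×-dec (key x ℕ.≟ v)
  open Enumeration (enumerate (λ (v : Fin (suc k)) → FP.any? (Fibre? (toℕ v))))
  I : Fin size → Subset n
  I j = ⟦ Fibre? (toℕ (elem j)) ⟧
  ∈I⁻ : ∀ {j x} → x ∈ I j → Fibre (toℕ (elem j)) x
  ∈I⁻ = ∈⟦⟧⁻ (Fibre? _)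
  ∈I⁺ : ∀ {j x} → Fibre (toℕ (elem j)) x → x ∈ I j
  ∈I⁺ = ∈⟦⟧⁺ (Fibre? _)
  nonempty : ∀ j → ∃ λ x → x ∈ I j
  nonempty j with elem-sat j
  ... | x , fx = x , ∈I⁺ fx
  disjoint : ∀ j j′ x → x ∈ I j → x ∈ I j′ → j ≡ j′
  disjoint j j′ x x∈ x∈′ = elem-injective j j′
    (FP.toℕ-injective (trans (sym (proj₂ (∈I⁻ x∈))) (proj₂ (∈I⁻ x∈′))))
  covers : ∀ x → x ∉ S → ∃ λ j → x ∈ I j
  covers x x∉S
    with elem-surjective (Fin.fromℕ< (s≤s (#cuts≤≤k c (toℕ x)))) (x , x∉S , sym (FP.toℕ-fromℕ< _))
  ... | j , eq = j , ∈I⁺ (x∉S , trans (sym (FP.toℕ-fromℕ< _)) (sym (cong toℕ eq)))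
  interval : ∀ j → IsInterval (∁ S) (I j)
  interval j with least (Fibre? (toℕ (elem j))) (elem-sat j)
               | greatest (Fibre? (toℕ (elem j))) (elem-sat j)
  ... | a , (_ , ka) , a≤ | b , (_ , kb) , ≤b = a , b , λ x →
        (λ x∈ → SP.x∉p⇒x∈∁p (proj₁ (∈I⁻ x∈)) , a≤ x (∈I⁻ x∈) , ≤b x (∈I⁻ x∈)) ,
        λ { (x∈∁S , a≤x , x≤b) → ∈I⁺ (SP.x∈∁p⇒x∉p x∈∁S ,
              ℕP.≤-antisym (subst (key x ≤_) kb (#cuts≤-mono c x≤b))
                           (subst (_≤ key x) ka (#cuts≤-mono c a≤x))) }
  uncut : ∀ j x y → x ∈ I j → y ∈ I j → ∀ q → c q ≤ toℕ x → c q ≤ toℕ y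
  uncut j x y x∈ y∈ = #cuts≤-≡⇒cut≤ c (trans (proj₂ (∈I⁻ x∈)) (sym (proj₂ (∈I⁻ y∈))))

-- A criterion for being a disjoint union of cliques

module _ {n m} (G : OGraph n) (part : Fin n → Fin m) (W : Subset n) where

  PartwiseUniform : Set
  PartwiseUniform = ∀ x y x′ y′ → x ∈ W → y ∈ W → x′ ∈ W → y′ ∈ W →
    part x ≡ part x′ → part y ≡ part y′ → ¬ part x ≡ part y → E G x y ≡ E G x′ y′

  NoRainbowInducedP₃ : Set
  NoRainbowInducedP₃ = ∀ x y z → x ∈ W → y ∈ W → z ∈ W →
    ¬ part x ≡ part y → ¬ part y ≡ part z → ¬ part x ≡ part z →
    E G x y ≡ true → E G y z ≡ true → ¬ E G x z ≡ false

module _ {n m} (G : OGraph n) (part : Fin n → Fin m)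
         (parts-cliques : ∀ i → IsClique G (λ x → part x ≡ i)) where

  -- On W (under the hypotheses below) this is an equivalence relation; its classes are the cliques.
  _~_ : Fin n → Fin n → Set
  x ~ y = x ≡ y ⊎ E G x y ≡ true

  _~?_ : ∀ x y → Dec (x ~ y)
  x ~? y = (x FP.≟ y) ⊎-dec (E G x y BP.≟ true)

  ~-sym : ∀ {x y} → x ~ y → y ~ x
  ~-sym (inj₁ refl) = inj₁ refl
  ~-sym {x} {y} (inj₂ e) = inj₂ (trans (E-sym G y x) e)

  same-part⇒~ : ∀ {x y} → part x ≡ part y → x ~ y
  same-part⇒~ {x} {y} eq with x FP.≟ y
  ... | yes x≡y = inj₁ x≡y
  ... | no x≢y = inj₂ (parts-cliques (part y) x y eq refl x≢y)

  module _ (W : Subset n) (uniform : PartwiseUniform G part W)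
           (no-P₃ : NoRainbowInducedP₃ G part W) where

    private
      ~-trans : ∀ {x y z} → x ∈ W → y ∈ W → z ∈ W → x ~ y → y ~ z → x ~ z
      ~-trans _ _ _ (inj₁ refl) y~z = y~z
      ~-trans _ _ _ x~y (inj₁ refl) = x~y
      ~-trans {x} {y} {z} x∈ y∈ z∈ (inj₂ exy) (inj₂ eyz)
        with part x FP.≟ part z | part x FP.≟ part y | part y FP.≟ part z
      ... | yes pxz | _ | _ = same-part⇒~ pxz
      ... | no pxz | yes pxy | _ = inj₂ (trans (uniform x z y z x∈ z∈ y∈ z∈ pxy refl pxz) eyz)
      ... | no pxz | no _ | yes pyz = inj₂ (trans (uniform x z x y x∈ z∈ x∈ y∈ refl (sym pyz) pxz) exy)
      ... | no pxz | no pxy | no pyz with E G x z in exz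
      ...   | true = inj₂ refl
      ...   | false = ⊥-elim (no-P₃ x y z x∈ y∈ z∈ pxy pyz pxz exy eyz exz)

      IsRep : Fin n → Set
      IsRep x = x ∈ W × (∀ y → y ∈ W → y ~ x → toℕ x ≤ toℕ y)

      IsRep? : ∀ x → Dec (IsRep x)
      IsRep? x = (x SP.∈? W) ×-dec FP.all? (λ y → (y SP.∈? W) →-dec ((y ~? x) →-dec (toℕ x ℕ.≤? toℕ y)))

      open Enumeration (enumerate IsRep?)

      rep∈W : ∀ l → elem l ∈ W
      rep∈W l = proj₁ (elem-sat l)

      rep-unique : ∀ l l′ → elem l ~ elem l′ → l ≡ l′
      rep-unique l l′ r = elem-injective l l′ (FP.toℕ-injective (ℕP.≤-antisym
        (proj₂ (elem-sat l) (elem l′) (rep∈W l′) (~-sym r))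
        (proj₂ (elem-sat l′) (elem l) (rep∈W l) r)))

      InClass : Fin size → Fin n → Set
      InClass l y = y ∈ W × y ~ elem l

      InClass? : ∀ l y → Dec (InClass l y)
      InClass? l y = (y SP.∈? W) ×-dec (y ~? elem l)

      Clique : Fin size → Subset n
      Clique l = ⟦ InClass? l ⟧

      ∈C⁻ : ∀ {l y} → y ∈ Clique l → InClass l y
      ∈C⁻ {l} = ∈⟦⟧⁻ (InClass? l)

      ∈C⁺ : ∀ {l y} → InClass l y → y ∈ Clique l
      ∈C⁺ {l} = ∈⟦⟧⁺ (InClass? l)

      same-class : ∀ {l l′ u v} → u ∈ Clique l → v ∈ Clique l′ → u ~ v → l ≡ l′
      same-class {l} {l′} u∈ v∈ u~v with ∈C⁻ u∈ | ∈C⁻ v∈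
      ... | u∈W , u~r | v∈W , v~r′ = rep-unique l l′
        (~-trans (rep∈W l) u∈W (rep∈W l′) (~-sym u~r) (~-trans u∈W v∈W (rep∈W l′) u~v v~r′))

      covers : ∀ x → x ∈ W → ∃ λ l → x ∈ Clique l
      covers x x∈W with least (λ y → (y SP.∈? W) ×-dec (y ~? x)) (x , x∈W , inj₁ refl)
      ... | a , (a∈W , a~x) , a≤ with elem-surjective a
            (a∈W , λ y y∈W y~a → a≤ y (y∈W , ~-trans y∈W a∈W x∈W y~a a~x))
      ...   | l , refl = l , ∈C⁺ (x∈W , ~-sym a~x)

      clique : ∀ l → IsClique G (λ x → x ∈ Clique l)
      clique l u v u∈ v∈ u≢v with ∈C⁻ u∈ | ∈C⁻ v∈
      ... | u∈W , u~r | v∈W , v~r with ~-trans u∈W (rep∈W l) v∈W u~r (~-sym v~r)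
      ...   | inj₁ u≡v = ⊥-elim (u≢v u≡v)
      ...   | inj₂ e = e

      MeetsClass : Fin size → Fin m → Set
      MeetsClass l i = ∃ λ y → y ∈ W × part y ≡ i × y ~ elem l

      MeetsClass? : ∀ l i → Dec (MeetsClass l i)
      MeetsClass? l i = FP.any? (λ y → (y SP.∈? W) ×-dec ((part y FP.≟ i) ×-dec (y ~? elem l)))

    disjointCliques : DUCliquesOfForm G part W
    disjointCliques =
      size , Clique , (λ l x → proj₁ ∘ ∈C⁻) , covers ,
      (λ l → elem l , ∈C⁺ (rep∈W l , inj₁ refl)) ,
      (λ l l′ x x∈ x∈′ → same-class x∈ x∈′ (inj₁ refl)) ,
      clique ,
      (λ l l′ u v l≢l′ u∈ v∈ → BP.¬-not (l≢l′ ∘ same-class u∈ v∈ ∘ inj₂)) ,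
      λ l → ⟦ MeetsClass? l ⟧ , λ x →
        (λ x∈ → proj₁ (∈C⁻ x∈) , ∈⟦⟧⁺ (MeetsClass? l) (x , proj₁ (∈C⁻ x∈) , refl , proj₂ (∈C⁻ x∈))) ,
        λ { (x∈W , px∈) → case ∈⟦⟧⁻ (MeetsClass? l) px∈ of λ { (y , y∈W , py≡px , y~r) →
              ∈C⁺ (x∈W , ~-trans x∈W y∈W (rep∈W l) (same-part⇒~ (sym py≡px)) y~r) } }

-- Sequences and induced copies of D

∧≡true⁻ : ∀ {a b} → a ∧ b ≡ true → a ≡ true × b ≡ true
∧≡true⁻ {true} {true} _ = refl , refl

∧≡true⁺ : ∀ {a b} → a ≡ true → b ≡ true → a ∧ b ≡ true
∧≡true⁺ refl refl = refl

<F-true : ∀ {N} {u v : Fin N} → toℕ u < toℕ v → (u <F v) ≡ true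
<F-true u<v = Equivalence.to BP.T-≡ (ℕP.<⇒<ᵇ u<v)

<F≡true⇒< : ∀ {N} {u v : Fin N} → (u <F v) ≡ true → toℕ u < toℕ v
<F≡true⇒< {u = u} {v} e = ℕP.<ᵇ⇒< (toℕ u) (toℕ v) (Equivalence.from BP.T-≡ e)

isSeq⁻ : ∀ {N} {A₁ A₂ A₃ : Subset N} {u v w} → isSeq A₁ A₂ A₃ u v w ≡ true →
  u ∈ A₁ × v ∈ A₂ × w ∈ A₃ × toℕ u < toℕ v × toℕ v < toℕ w
isSeq⁻ seq with ∧≡true⁻ seq
... | u∈ , rest₁ with ∧≡true⁻ rest₁
... | v∈ , rest₂ with ∧≡true⁻ rest₂
... | w∈ , rest₃ with ∧≡true⁻ rest₃
... | u<v , v<w = lookup≡true⇒∈ u∈ , lookup≡true⇒∈ v∈ , lookup≡true⇒∈ w∈ , <F≡true⇒< u<v , <F≡true⇒< v<w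

isSeq⁺ : ∀ {N} {A₁ A₂ A₃ : Subset N} {u v w} → u ∈ A₁ → v ∈ A₂ → w ∈ A₃ →
  toℕ u < toℕ v → toℕ v < toℕ w → isSeq A₁ A₂ A₃ u v w ≡ true
isSeq⁺ u∈ v∈ w∈ u<v v<w = ∧≡true⁺ (∈⇒lookup≡true u∈) (∧≡true⁺ (∈⇒lookup≡true v∈)
  (∧≡true⁺ (∈⇒lookup≡true w∈) (∧≡true⁺ (<F-true u<v) (<F-true v<w))))

isD⁺ : ∀ {n} (G : OGraph n) {u v w} → toℕ u < toℕ v → toℕ v < toℕ w →
  E G u v ≡ true → E G u w ≡ true → E G v w ≡ false → isD G u v w ≡ true
isD⁺ G u<v v<w euv euw evw = ∧≡true⁺ (<F-true u<v) (∧≡true⁺ (<F-true v<w)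
  (∧≡true⁺ euv (∧≡true⁺ euw (cong not evw))))

D-free⇒edge : ∀ {n} (G : OGraph n) {u v w} → isD G u v w ≡ false →
  toℕ u < toℕ v → toℕ v < toℕ w → E G u v ≡ true → E G u w ≡ true → E G v w ≡ true
D-free⇒edge G D-free u<v v<w euv euw = BP.¬-not λ evw →
  case trans (sym D-free) (isD⁺ G u<v v<w euv euw evw) of λ ()

pair-pigeonhole : ∀ {A : Set} {i j a b c : A} → (a ≡ i ⊎ a ≡ j) → (b ≡ i ⊎ b ≡ j) →
  (c ≡ i ⊎ c ≡ j) → ¬ a ≡ c → ¬ b ≡ c → a ≡ b
pair-pigeonhole (inj₁ refl) (inj₁ refl) _ _ _ = refl
pair-pigeonhole (inj₂ refl) (inj₂ refl) _ _ _ = refl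
pair-pigeonhole (inj₁ refl) (inj₂ refl) (inj₁ refl) a≢c _ = ⊥-elim (a≢c refl)
pair-pigeonhole (inj₁ refl) (inj₂ refl) (inj₂ refl) _ b≢c = ⊥-elim (b≢c refl)
pair-pigeonhole (inj₂ refl) (inj₁ refl) (inj₁ refl) _ b≢c = ⊥-elim (b≢c refl)
pair-pigeonhole (inj₂ refl) (inj₁ refl) (inj₂ refl) a≢c _ = ⊥-elim (a≢c refl)

module _ {n m} (G : OGraph n) (part : Fin n → Fin m)
         (parts-cliques : ∀ i → IsClique G (λ x → part x ≡ i)) where

  same-part⇒edge : ∀ {x y} → part x ≡ part y → toℕ x < toℕ y → E G x y ≡ true
  same-part⇒edge {x} {y} eq x<y = parts-cliques (part y) x y eq refl (FP.<⇒≢ x<y)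

  same-part⇒¬isD : ∀ u v w → part v ≡ part w → isD G u v w ≡ false
  same-part⇒¬isD u v w pv≡pw with toℕ v ℕ.<? toℕ w
  ... | no v≮w rewrite BP.¬-not (v≮w ∘ <F≡true⇒< {u = v} {w}) = BP.∧-zeroʳ (u <F v)
  ... | yes v<w rewrite same-part⇒edge pv≡pw v<w | BP.∧-zeroʳ (E G u w)
                      | BP.∧-zeroʳ (E G u v) | BP.∧-zeroʳ (v <F w) = BP.∧-zeroʳ (u <F v)

module _ {n m} (part : Fin n → Fin m) (i j : Fin m) where

  InPair : Fin n → Set
  InPair x = part x ≡ i ⊎ part x ≡ j

  InPair? : ∀ x → Dec (InPair x)
  InPair? x = (part x FP.≟ i) ⊎-dec (part x FP.≟ j)

module _ {n m} (G : OGraph n) (part : Fin n → Fin m) (i j : Fin m) where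

  DFreeOnPair : Set
  DFreeOnPair = ∀ u v w → InPair part i j u → InPair part i j v → InPair part i j w → isD G u v w ≡ false

  Threshold : ℕ → Set
  Threshold β = ∀ x y → InPair part i j x → InPair part i j y → ¬ part x ≡ part y →
    (β ≤ toℕ x → β ≤ toℕ y → E G x y ≡ true) × (toℕ x < β → toℕ y < β → E G x y ≡ false)

ordered-pairs⇒all-pairs-D-free : ∀ {n m} (G : OGraph n) (part : Fin n → Fin m) →
  (∀ i → IsClique G (λ x → part x ≡ i)) →
  (∀ i j → i Fin.< j → DFreeOnPair G part i j) → ∀ i j → DFreeOnPair G part i j
ordered-pairs⇒all-pairs-D-free G part parts-cliques D-free i j u v w pu pv pw with FP.<-cmp i j
... | tri< i<j _ _ = D-free i j i<j u v w pu pv pw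
... | tri> _ _ j<i = D-free j i j<i u v w (swap pu) (swap pv) (swap pw)
... | tri≈ _ refl _ = same-part⇒¬isD G part parts-cliques u v w (trans (only pv) (sym (only pw)))
  where
  only : ∀ {x} → x ≡ i ⊎ x ≡ i → x ≡ i
  only (inj₁ e) = e
  only (inj₂ e) = e

-- The threshold between two parts

module _ {n m} (G : OGraph n) (part : Fin n → Fin m)
         (parts-cliques : ∀ i → IsClique G (λ x → part x ≡ i)) (i j : Fin m)
         (D-free : DFreeOnPair G part i j) where

  private
    In : Fin n → Set
    In = InPair part i j

  HasEarlierCrossNeighbour : Fin n → Set
  HasEarlierCrossNeighbour z = In z ×
    ∃ λ p → In p × ¬ part p ≡ part z × toℕ p < toℕ z × E G p z ≡ true

  HasEarlierCrossNeighbour? : ∀ z → Dec (HasEarlierCrossNeighbour z)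
  HasEarlierCrossNeighbour? z = InPair? part i j z ×-dec FP.any? λ p → InPair? part i j p ×-dec
    (¬? (part p FP.≟ part z) ×-dec ((toℕ p ℕ.<? toℕ z) ×-dec (E G p z BP.≟ true)))

  cross-edge⇒later-end : ∀ x y → In x → In y → ¬ part x ≡ part y → E G x y ≡ true →
    (toℕ x < toℕ y × HasEarlierCrossNeighbour y) ⊎ (toℕ y < toℕ x × HasEarlierCrossNeighbour x)
  cross-edge⇒later-end x y px py px≢py exy with ℕP.<-cmp (toℕ x) (toℕ y)
  ... | tri< x<y _ _ = inj₁ (x<y , py , x , px , px≢py , x<y , exy)
  ... | tri≈ _ x≡y _ = ⊥-elim (px≢py (cong part (FP.toℕ-injective x≡y)))
  ... | tri> _ _ y<x = inj₂ (y<x , px , y , py , px≢py ∘ sym , y<x , trans (E-sym G y x) exy)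

  -- The threshold is the first vertex z having an earlier neighbour p in the other part (n if
  -- there is none). D-freeness of p < z < w makes z adjacent to all later vertices of p's part,
  -- and D-freeness of triples starting at z then makes every cross pair beyond z adjacent.
  threshold : ∃ (Threshold G part i j)
  threshold with least? HasEarlierCrossNeighbour?
  ... | inj₂ none = n , λ x y px py px≢py →
        (λ n≤x _ → ⊥-elim (ℕP.<⇒≱ (FP.toℕ<n x) n≤x)) ,
        λ _ _ → BP.¬-not λ exy →
          [ none y ∘ proj₂ , none x ∘ proj₂ ]′ (cross-edge⇒later-end x y px py px≢py exy)
  ... | inj₁ (z , (pz , p , pp , pp≢pz , p<z , epz) , z≤) = toℕ z , λ x y px py px≢py →
        above x y px py px≢py , below x y px py px≢py
    where
    z-sees-p's-part : ∀ w → In w → part w ≡ part p → toℕ z < toℕ w → E G z w ≡ true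
    z-sees-p's-part w pw pw≡pp z<w = D-free⇒edge G (D-free p z w pp pz pw) p<z z<w epz
      (same-part⇒edge G part parts-cliques (sym pw≡pp) (ℕP.<-trans p<z z<w))

    above< : ∀ x y → In x → In y → ¬ part x ≡ part y →
      toℕ z ≤ toℕ x → toℕ x < toℕ y → E G x y ≡ true
    above< x y px py px≢py z≤x x<y with x FP.≟ z
    ... | yes refl = z-sees-p's-part y py (pair-pigeonhole py pp px (px≢py ∘ sym) pp≢pz) x<y
    ... | no x≢z with ℕP.≤∧≢⇒< z≤x (x≢z ∘ FP.toℕ-injective ∘ sym) | part x FP.≟ part z
    ...   | z<x | yes px≡pz = D-free⇒edge G (D-free z x y pz px py) z<x x<y
            (same-part⇒edge G part parts-cliques (sym px≡pz) z<x)
            (z-sees-p's-part y py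
              (pair-pigeonhole py pp pz (λ py≡pz → px≢py (trans px≡pz (sym py≡pz))) pp≢pz)
              (ℕP.<-trans z<x x<y))
    ...   | z<x | no px≢pz = D-free⇒edge G (D-free z x y pz px py) z<x x<y
            (z-sees-p's-part x px (pair-pigeonhole px pp pz px≢pz pp≢pz) z<x)
            (same-part⇒edge G part parts-cliques (pair-pigeonhole pz py px (px≢pz ∘ sym) (px≢py ∘ sym))
              (ℕP.<-trans z<x x<y))

    above : ∀ x y → In x → In y → ¬ part x ≡ part y →
      toℕ z ≤ toℕ x → toℕ z ≤ toℕ y → E G x y ≡ true
    above x y px py px≢py z≤x z≤y with ℕP.<-cmp (toℕ x) (toℕ y)
    ... | tri< x<y _ _ = above< x y px py px≢py z≤x x<y
    ... | tri≈ _ x≡y _ = ⊥-elim (px≢py (cong part (FP.toℕ-injective x≡y)))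
    ... | tri> _ _ y<x = trans (E-sym G x y) (above< y x py px (px≢py ∘ sym) z≤y y<x)

    below : ∀ x y → In x → In y → ¬ part x ≡ part y →
      toℕ x < toℕ z → toℕ y < toℕ z → E G x y ≡ false
    below x y px py px≢py x<z y<z = BP.¬-not λ exy →
      [ (λ (_ , hy) → ℕP.<⇒≱ y<z (z≤ y hy)) , (λ (_ , hx) → ℕP.<⇒≱ x<z (z≤ x hx)) ]′
        (cross-edge⇒later-end x y px py px≢py exy)

-- Arithmetic

toℚᵘ-ℕ→ℚ : ∀ a → ℚ.toℚᵘ (ℕ→ℚ a) ℚᵘ.≃ mkℚᵘ (+ a) 0
toℚᵘ-ℕ→ℚ a = ℚP.toℚᵘ-fromℚᵘ (mkℚᵘ (+ a) 0)

ℕ→ℚ-+ : ∀ a b → ℕ→ℚ (a ℕ.+ b) ≡ ℕ→ℚ a + ℕ→ℚ b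
ℕ→ℚ-+ a b = ℚP.toℚᵘ-injective (begin
  ℚ.toℚᵘ (ℕ→ℚ (a ℕ.+ b))                    ≈⟨ toℚᵘ-ℕ→ℚ (a ℕ.+ b) ⟩
  mkℚᵘ (+ (a ℕ.+ b)) 0                      ≈⟨ *≡* (cong (ℤ._* + 1) (trans (ℤP.pos-+ a b)
                                                (sym (cong₂ ℤ._+_ (ℤP.*-identityʳ (+ a)) (ℤP.*-identityʳ (+ b)))))) ⟩
  mkℚᵘ (+ a) 0 ℚᵘ.+ mkℚᵘ (+ b) 0            ≈⟨ ℚᵘP.+-cong (toℚᵘ-ℕ→ℚ a) (toℚᵘ-ℕ→ℚ b) ⟨
  ℚ.toℚᵘ (ℕ→ℚ a) ℚᵘ.+ ℚ.toℚᵘ (ℕ→ℚ b)        ≈⟨ ℚP.toℚᵘ-homo-+ (ℕ→ℚ a) (ℕ→ℚ b) ⟨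
  ℚ.toℚᵘ (ℕ→ℚ a + ℕ→ℚ b)                    ∎)
  where
  open ℚᵘP.≃-Reasoning

ℕ→ℚ-* : ∀ a b → ℕ→ℚ (a ℕ.* b) ≡ ℕ→ℚ a * ℕ→ℚ b
ℕ→ℚ-* a b = ℚP.toℚᵘ-injective (begin
  ℚ.toℚᵘ (ℕ→ℚ (a ℕ.* b))                    ≈⟨ toℚᵘ-ℕ→ℚ (a ℕ.* b) ⟩
  mkℚᵘ (+ (a ℕ.* b)) 0                      ≈⟨ *≡* (cong (ℤ._* + 1) (ℤP.pos-* a b)) ⟩
  mkℚᵘ (+ a) 0 ℚᵘ.* mkℚᵘ (+ b) 0            ≈⟨ ℚᵘP.*-cong (toℚᵘ-ℕ→ℚ a) (toℚᵘ-ℕ→ℚ b) ⟨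
  ℚ.toℚᵘ (ℕ→ℚ a) ℚᵘ.* ℚ.toℚᵘ (ℕ→ℚ b)        ≈⟨ ℚP.toℚᵘ-homo-* (ℕ→ℚ a) (ℕ→ℚ b) ⟨
  ℚ.toℚᵘ (ℕ→ℚ a * ℕ→ℚ b)                    ∎)
  where open ℚᵘP.≃-Reasoning

ℕ→ℚ-^ : ∀ a k → ℕ→ℚ (a ℕ.^ k) ≡ ℕ→ℚ a ^ℚ k
ℕ→ℚ-^ a zero = refl
ℕ→ℚ-^ a (suc k) = trans (ℕ→ℚ-* a (a ℕ.^ k)) (cong (ℕ→ℚ a *_) (ℕ→ℚ-^ a k))

ℕ→ℚ-mono : ∀ {a b} → a ≤ b → ℕ→ℚ a ≤ℚ ℕ→ℚ b
ℕ→ℚ-mono {a} {b} a≤b = ℚP.toℚᵘ-cancel-≤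
  (ℚᵘP.≤-respˡ-≃ (ℚᵘP.≃-sym (toℚᵘ-ℕ→ℚ a)) (ℚᵘP.≤-respʳ-≃ (ℚᵘP.≃-sym (toℚᵘ-ℕ→ℚ b))
    (*≤* (ℤP.*-monoʳ-≤-nonNeg (+ 1) (ℤ.+≤+ a≤b)))))

ℕ→ℚ-nonNeg : ∀ a → 0ℚ ≤ℚ ℕ→ℚ a
ℕ→ℚ-nonNeg a = ℕ→ℚ-mono {0} {a} z≤n

ℕ→ℚ-pos : ∀ a → 1 ≤ a → 0ℚ <ℚ ℕ→ℚ a
ℕ→ℚ-pos a 1≤a = ℚP.<-≤-trans (ℚP.positive⁻¹ 1ℚ) (ℕ→ℚ-mono {1} {a} 1≤a)

*-nonNeg : ∀ {p q} → 0ℚ ≤ℚ p → 0ℚ ≤ℚ q → 0ℚ ≤ℚ p * q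
*-nonNeg {p} {q} 0≤p 0≤q = ℚP.nonNegative⁻¹ (p * q)
  {{ℚP.nonNeg*nonNeg⇒nonNeg p {{ℚ.nonNegative 0≤p}} q {{ℚ.nonNegative 0≤q}}}}

^ℚ-nonNeg : ∀ {q} k → 0ℚ ≤ℚ q → 0ℚ ≤ℚ q ^ℚ k
^ℚ-nonNeg zero _ = ℚP.<⇒≤ (ℚP.positive⁻¹ 1ℚ)
^ℚ-nonNeg (suc k) 0≤q = *-nonNeg 0≤q (^ℚ-nonNeg k 0≤q)

^ℚ≤1 : ∀ {q} k → 0ℚ ≤ℚ q → q ≤ℚ 1ℚ → q ^ℚ k ≤ℚ 1ℚ
^ℚ≤1 zero _ _ = ℚP.≤-refl
^ℚ≤1 {q} (suc k) 0≤q q≤1 = begin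
  q * q ^ℚ k    ≤⟨ ℚP.*-monoʳ-≤-nonNeg (q ^ℚ k) {{ℚ.nonNegative (^ℚ-nonNeg k 0≤q)}} q≤1 ⟩
  1ℚ * q ^ℚ k   ≡⟨ ℚP.*-identityˡ (q ^ℚ k) ⟩
  q ^ℚ k        ≤⟨ ^ℚ≤1 k 0≤q q≤1 ⟩
  1ℚ            ∎
  where open ℚP.≤-Reasoning

module _ where
  open import Data.Rational.Solver using (module +-*-Solver)
  open +-*-Solver

  private
    infix 9 _:^ℚ_
    _:^ℚ_ : ∀ {k} → Polynomial k → ℕ → Polynomial k
    x :^ℚ zero = con 1ℚ
    x :^ℚ suc k = x :* (x :^ℚ k)

  -- γ ≤ 1 absorbs the surplus factor γ³ of the hypothesis, and K r = 1 undoes the division by K.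
  rescaled-count-bound : ∀ {c₃ γ N D M K r} → 0ℚ ≤ℚ c₃ → 0ℚ ≤ℚ γ → γ ≤ℚ 1ℚ → 0ℚ ≤ℚ N → 0ℚ ≤ℚ D →
    0ℚ ≤ℚ r → K * r ≡ 1ℚ → K ^ℚ 3 ≤ℚ ℕ→ℚ 64 * M →
    D * M ≤ℚ (c₃ * (+ 1 / 64)) * (γ ^ℚ 6) * (N ^ℚ 3) →
    D ≤ℚ c₃ * ((γ * r) ^ℚ 3) * (N ^ℚ 3)
  rescaled-count-bound {c₃} {γ} {N} {D} {M} {K} {r} 0≤c₃ 0≤γ γ≤1 0≤N 0≤D 0≤r Kr≡1 K³≤64M DM≤ = begin
    D
      ≡⟨ trans (sym (ℚP.*-identityʳ D)) (cong (λ x → D * x ^ℚ 3) (sym Kr≡1)) ⟩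
    D * (K * r) ^ℚ 3
      ≡⟨ solve 3 (λ D K r → D :* (K :* r) :^ℚ 3 := (D :* K :^ℚ 3) :* r :^ℚ 3) refl D K r ⟩
    (D * K ^ℚ 3) * r ^ℚ 3
      ≤⟨ *-monoʳ (r ^ℚ 3) (^ℚ-nonNeg 3 0≤r) (*-monoˡ D 0≤D K³≤64M) ⟩
    (D * (ℕ→ℚ 64 * M)) * r ^ℚ 3
      ≡⟨ solve 4 (λ D s M r³ → (D :* (s :* M)) :* r³ := (s :* (D :* M)) :* r³) refl D (ℕ→ℚ 64) M (r ^ℚ 3) ⟩
    (ℕ→ℚ 64 * (D * M)) * r ^ℚ 3
      ≤⟨ *-monoʳ (r ^ℚ 3) (^ℚ-nonNeg 3 0≤r) (*-monoˡ (ℕ→ℚ 64) (ℕ→ℚ-nonNeg 64) DM≤) ⟩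
    (ℕ→ℚ 64 * ((c₃ * (+ 1 / 64)) * γ ^ℚ 6 * N ^ℚ 3)) * r ^ℚ 3
      ≡⟨ solve 6 (λ s t c g N r →
           (s :* ((c :* t) :* g :^ℚ 6 :* N :^ℚ 3)) :* r :^ℚ 3
             := (s :* t) :* (((c :* g :^ℚ 3 :* N :^ℚ 3) :* r :^ℚ 3) :* g :^ℚ 3))
         refl (ℕ→ℚ 64) (+ 1 / 64) c₃ γ N r ⟩
    1ℚ * (((c₃ * γ ^ℚ 3 * N ^ℚ 3) * r ^ℚ 3) * γ ^ℚ 3)
      ≡⟨ ℚP.*-identityˡ _ ⟩
    ((c₃ * γ ^ℚ 3 * N ^ℚ 3) * r ^ℚ 3) * γ ^ℚ 3
      ≤⟨ *-monoˡ _ rest≥0 (^ℚ≤1 3 0≤γ γ≤1) ⟩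
    ((c₃ * γ ^ℚ 3 * N ^ℚ 3) * r ^ℚ 3) * 1ℚ
      ≡⟨ solve 4 (λ c g N r → ((c :* g :^ℚ 3 :* N :^ℚ 3) :* r :^ℚ 3) :* con 1ℚ
                                := c :* (g :* r) :^ℚ 3 :* N :^ℚ 3) refl c₃ γ N r ⟩
    c₃ * (γ * r) ^ℚ 3 * N ^ℚ 3
      ∎
    where
    open ℚP.≤-Reasoning
    *-monoˡ : ∀ {p q} s → 0ℚ ≤ℚ s → p ≤ℚ q → s * p ≤ℚ s * q
    *-monoˡ s 0≤s = ℚP.*-monoˡ-≤-nonNeg s {{ℚ.nonNegative 0≤s}}
    *-monoʳ : ∀ {p q} s → 0ℚ ≤ℚ s → p ≤ℚ q → p * s ≤ℚ q * s
    *-monoʳ s 0≤s = ℚP.*-monoʳ-≤-nonNeg s {{ℚ.nonNegative 0≤s}}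
    rest≥0 : 0ℚ ≤ℚ (c₃ * γ ^ℚ 3 * N ^ℚ 3) * r ^ℚ 3
    rest≥0 = *-nonNeg (*-nonNeg (*-nonNeg 0≤c₃ (^ℚ-nonNeg 3 0≤γ)) (^ℚ-nonNeg 3 0≤N)) (^ℚ-nonNeg 3 0≤r)

module _ where
  open import Data.Nat.Solver using (module +-*-Solver)
  open +-*-Solver

  #hittingSets³≤64m¹⁵ : ∀ m → 1 ≤ m → (suc (m ℕ.* m) ℕ.* (m ℕ.* (m ℕ.* m))) ℕ.^ 3 ≤ 64 ℕ.* m ℕ.^ 15
  #hittingSets³≤64m¹⁵ m 1≤m = begin
    (suc (m ℕ.* m) ℕ.* (m ℕ.* (m ℕ.* m))) ℕ.^ 3
      ≤⟨ ℕP.^-monoˡ-≤ 3 (ℕP.*-monoˡ-≤ (m ℕ.* (m ℕ.* m)) (ℕP.+-monoˡ-≤ (m ℕ.* m) 1≤m²)) ⟩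
    ((m ℕ.* m ℕ.+ m ℕ.* m) ℕ.* (m ℕ.* (m ℕ.* m))) ℕ.^ 3
      ≡⟨ solve 1 (λ m → ((m :* m :+ m :* m) :* (m :* (m :* m))) :^ 3 := con 8 :* m :^ 15) refl m ⟩
    8 ℕ.* m ℕ.^ 15
      ≤⟨ ℕP.*-monoˡ-≤ (m ℕ.^ 15) (ℕP.m≤m+n 8 56) ⟩
    64 ℕ.* m ℕ.^ 15
      ∎
    where
    open ℕP.≤-Reasoning
    1≤m² : 1 ≤ m ℕ.* m
    1≤m² = ℕP.*-mono-≤ 1≤m 1≤m

  -- For m = k + 2 the right side exceeds the left by k³ + 5k² + 7k + 1.
  #intervals≤2m³ : ∀ m → 2 ≤ m → suc (m ℕ.* m ℕ.+ suc (m ℕ.* m) ℕ.* m) ≤ 2 ℕ.* m ℕ.^ 3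
  #intervals≤2m³ (suc zero) (s≤s ())
  #intervals≤2m³ (suc (suc k)) _ =
    ℕP.≤-trans (ℕP.m≤m+n _ (k ℕ.* k ℕ.* k ℕ.+ 5 ℕ.* (k ℕ.* k) ℕ.+ 7 ℕ.* k ℕ.+ 1))
      (ℕP.≤-reflexive (solve 1 (λ k → let m = con 2 :+ k in
        (con 1 :+ (m :* m :+ (con 1 :+ m :* m) :* m))
          :+ (k :* k :* k :+ con 5 :* (k :* k) :+ con 7 :* k :+ con 1)
          := con 2 :* m :^ 3) refl k))

∣p∪q∣≤∣p∣+∣q∣ : ∀ {n} (p q : Subset n) → ∣ p ∪ q ∣ ≤ ∣ p ∣ ℕ.+ ∣ q ∣
∣p∪q∣≤∣p∣+∣q∣ [] [] = z≤n
∣p∪q∣≤∣p∣+∣q∣ (true ∷ p) (true ∷ q) =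
  s≤s (ℕP.≤-trans (∣p∪q∣≤∣p∣+∣q∣ p q) (ℕP.+-monoʳ-≤ ∣ p ∣ (ℕP.n≤1+n ∣ q ∣)))
∣p∪q∣≤∣p∣+∣q∣ (true ∷ p) (false ∷ q) = s≤s (∣p∪q∣≤∣p∣+∣q∣ p q)
∣p∪q∣≤∣p∣+∣q∣ (false ∷ p) (true ∷ q) =
  ℕP.≤-trans (s≤s (∣p∪q∣≤∣p∣+∣q∣ p q)) (ℕP.≤-reflexive (sym (ℕP.+-suc ∣ p ∣ ∣ q ∣)))
∣p∪q∣≤∣p∣+∣q∣ (false ∷ p) (false ∷ q) = ∣p∪q∣≤∣p∣+∣q∣ p q

⋃ᶠ : ∀ {n k} → (Fin k → Subset n) → Subset n
⋃ᶠ {k = zero} F = ⊥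
⋃ᶠ {k = suc k} F = F Fin.zero ∪ ⋃ᶠ (F ∘ Fin.suc)

∈⋃ᶠ : ∀ {n k} (F : Fin k → Subset n) i {x} → x ∈ F i → x ∈ ⋃ᶠ F
∈⋃ᶠ F Fin.zero x∈ = SP.p⊆p∪q (⋃ᶠ (F ∘ Fin.suc)) x∈
∈⋃ᶠ F (Fin.suc i) x∈ = SP.q⊆p∪q (F Fin.zero) _ (∈⋃ᶠ (F ∘ Fin.suc) i x∈)

∣⋃ᶠ∣≤ : ∀ {n k} (F : Fin k → Subset n) {e} → (∀ i → ℕ→ℚ ∣ F i ∣ ≤ℚ e) → ℕ→ℚ ∣ ⋃ᶠ F ∣ ≤ℚ ℕ→ℚ k * e
∣⋃ᶠ∣≤ {n} {zero} F {e} _ rewrite SP.∣⊥∣≡0 n = ℚP.≤-reflexive (sym (ℚP.*-zeroˡ e))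
∣⋃ᶠ∣≤ {k = suc k} F {e} F≤e = begin
  ℕ→ℚ ∣ F₀ ∪ ⋃ᶠ F₊ ∣            ≤⟨ ℕ→ℚ-mono (∣p∪q∣≤∣p∣+∣q∣ F₀ (⋃ᶠ F₊)) ⟩
  ℕ→ℚ (∣ F₀ ∣ ℕ.+ ∣ ⋃ᶠ F₊ ∣)      ≡⟨ ℕ→ℚ-+ ∣ F₀ ∣ ∣ ⋃ᶠ F₊ ∣ ⟩
  (ℕ→ℚ ∣ F₀ ∣) + (ℕ→ℚ ∣ ⋃ᶠ F₊ ∣)  ≤⟨ ℚP.+-mono-≤ (F≤e Fin.zero) (∣⋃ᶠ∣≤ F₊ (F≤e ∘ Fin.suc)) ⟩
  e + ℕ→ℚ k * e                 ≡⟨ cong (_+ ℕ→ℚ k * e) (ℚP.*-identityˡ e) ⟨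
  1ℚ * e + ℕ→ℚ k * e            ≡⟨ ℚP.*-distribʳ-+ e 1ℚ (ℕ→ℚ k) ⟨
  (1ℚ + ℕ→ℚ k) * e              ≡⟨ cong (_* e) (ℕ→ℚ-+ 1 k) ⟨
  ℕ→ℚ (suc k) * e               ∎
  where
  open ℚP.≤-Reasoning
  F₀ = F Fin.zero
  F₊ = F ∘ Fin.suc

count3-mono : ∀ {N} (P Q : Fin N → Fin N → Fin N → Bool) →
  (∀ u v w → P u v w ≡ true → Q u v w ≡ true) → count3 P ≤ count3 Q
count3-mono {N} P Q P⇒Q =
  sum-mono λ u → sum-mono λ v → sum-mono λ w → indicator-mono (P⇒Q u v w)
  where
  sum-mono : ∀ {f g : Fin N → ℕ} → (∀ x → f x ≤ g x) → sum (map f (allFin N)) ≤ sum (map g (allFin N))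
  sum-mono {f} {g} f≤g = go (allFin N)
    where
    go : ∀ xs → sum (map f xs) ≤ sum (map g xs)
    go [] = z≤n
    go (x ∷ xs) = ℕP.+-mono-≤ (f≤g x) (go xs)
  indicator-mono : ∀ {a b : Bool} → (a ≡ true → b ≡ true) → (if a then 1 else 0) ≤ (if b then 1 else 0)
  indicator-mono {false} _ = z≤n
  indicator-mono {true} a⇒b rewrite a⇒b refl = ℕP.≤-refl

IntervalCliqueDecomposition : ∀ {n m} → OGraph n → (Fin n → Fin m) → ℚ → Set
IntervalCliqueDecomposition {n} {m} G part γ =
  Σ (Subset n) λ S → (ℕ→ℚ ∣ S ∣ ≤ℚ γ * ℕ→ℚ n) ×
  Σ ℕ λ t → Σ (Fin t → Subset n) λ I →
    (t ≤ 2 ℕ.* (m ℕ.^ 3)) ×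
    (∀ j → IsInterval (∁ S) (I j)) ×
    (∀ j → ∃ λ x → x ∈ I j) ×
    (∀ j j′ x → x ∈ I j → x ∈ I j′ → j ≡ j′) ×
    (∀ x → x ∉ S → ∃ λ j → x ∈ I j) ×
    (∀ j → DUCliquesOfForm G part (I j))

module Construction
  (c₃ : ℚ) (0<c₃ : 0ℚ <ℚ c₃) (c₃-property : C3Property c₃)
  {n m : ℕ} (2≤m : 2 ≤ m) (G : OGraph n) (part : Fin n → Fin m)
  (parts-cliques : ∀ i → IsClique G (λ x → part x ≡ i))
  (pairs-D-free : ∀ i j → i Fin.< j → DFreeOnPair G part i j)
  (γ : ℚ) (0<γ : 0ℚ <ℚ γ) (γ≤1 : γ ≤ℚ 1ℚ)
  (few-Ds : ℕ→ℚ (numD G) * ℕ→ℚ (m ℕ.^ 15) ≤ℚ (c₃ * (+ 1 / 64)) * (γ ^ℚ 6) * (ℕ→ℚ n ^ℚ 3))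
  where

  D-free : ∀ i j → DFreeOnPair G part i j
  D-free = ordered-pairs⇒all-pairs-D-free G part parts-cliques pairs-D-free

  opaque
    θ : Fin m → Fin m → ℕ
    θ i j = proj₁ (threshold G part parts-cliques i j (D-free i j))

    θ-threshold : ∀ i j → Threshold G part i j (θ i j)
    θ-threshold i j = proj₂ (threshold G part parts-cliques i j (D-free i j))

  breakpoint : Fin (m ℕ.* m) → ℕ
  breakpoint = uncurry θ ∘ Fin.remQuot m

  breakpoint-combine : ∀ i j → breakpoint (Fin.combine i j) ≡ θ i j
  breakpoint-combine i j = cong (uncurry θ) (FP.remQuot-combine i j)

  Layer : Set
  Layer = Fin (suc (m ℕ.* m))

  layer : Fin n → ℕ
  layer x = #cuts≤ breakpoint (toℕ x)

  layerᶠ : Fin n → Layer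
  layerᶠ x = Fin.fromℕ< (s≤s (#cuts≤≤k breakpoint (toℕ x)))

  toℕ-layerᶠ : ∀ x → toℕ (layerᶠ x) ≡ layer x
  toℕ-layerᶠ x = FP.toℕ-fromℕ< _

  θ≤⇒#cuts≤ : ∀ {i j v} → θ i j ≤ v → #cuts≤ breakpoint (θ i j) ≤ #cuts≤ breakpoint v
  θ≤⇒#cuts≤ = #cuts≤-mono breakpoint

  #cuts≤⇒θ≤ : ∀ {i j v} → #cuts≤ breakpoint (θ i j) ≤ #cuts≤ breakpoint v → θ i j ≤ v
  #cuts≤⇒θ≤ {i} {j} rewrite sym (breakpoint-combine i j) = #cuts≤-reflects-cut≤ breakpoint (Fin.combine i j)

  θ≤-same-layer : ∀ {i j x y} → layer x ≡ layer y → θ i j ≤ toℕ x → θ i j ≤ toℕ y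
  θ≤-same-layer same θ≤x = #cuts≤⇒θ≤ (subst (_ ≤_) same (θ≤⇒#cuts≤ θ≤x))

  -- Parts i and j are joined in layer ℓ iff their threshold lies in layer ℓ or below.
  joined : ℕ → Fin m → Fin m → Bool
  joined ℓ i j = does (#cuts≤ breakpoint (θ i j) ℕ.≤? ℓ)

  edge-by-layer : ∀ x y → layer x ≡ layer y → ¬ part x ≡ part y →
    E G x y ≡ joined (layer x) (part x) (part y)
  edge-by-layer x y same px≢py = by-θ (θ (part x) (part y) ℕ.≤? toℕ x)
    where
    θxy = θ (part x) (part y)
    threshold-xy : (θxy ≤ toℕ x → θxy ≤ toℕ y → E G x y ≡ true) ×
                   (toℕ x < θxy → toℕ y < θxy → E G x y ≡ false)
    threshold-xy = θ-threshold (part x) (part y) x y (inj₁ refl) (inj₂ refl) px≢py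
    by-θ : Dec (θxy ≤ toℕ x) → E G x y ≡ joined (layer x) (part x) (part y)
    by-θ (yes θ≤x) = trans (proj₁ threshold-xy θ≤x (θ≤-same-layer same θ≤x))
                           (sym (dec-true (_ ℕ.≤? layer x) (θ≤⇒#cuts≤ θ≤x)))
    by-θ (no θ≰x) = trans (proj₂ threshold-xy (ℕP.≰⇒> θ≰x) (ℕP.≰⇒> (θ≰x ∘ θ≤-same-layer (sym same))))
                          (sym (dec-false (_ ℕ.≤? layer x) (θ≰x ∘ #cuts≤⇒θ≤)))

  InLayer : Layer → Fin m → Fin n → Set
  InLayer ℓ i u = layer u ≡ toℕ ℓ × part u ≡ i

  InLayer? : ∀ ℓ i u → Dec (InLayer ℓ i u)
  InLayer? ℓ i u = (layer u ℕ.≟ toℕ ℓ) ×-dec (part u FP.≟ i)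

  A : Layer → Fin m → Subset n
  A ℓ i = ⟦ InLayer? ℓ i ⟧

  A-disjoint : ∀ ℓ {i j} → ¬ i ≡ j → Disjoint (A ℓ i) (A ℓ j)
  A-disjoint ℓ {i} {j} i≢j x (x∈i , x∈j) =
    i≢j (trans (sym (proj₂ (∈⟦⟧⁻ (InLayer? ℓ i) x∈i))) (proj₂ (∈⟦⟧⁻ (InLayer? ℓ j) x∈j)))

  edge-in-layer : ∀ (ℓ : Layer) {x y} → layer x ≡ toℕ ℓ → layer y ≡ toℕ ℓ → ¬ part x ≡ part y →
    E G x y ≡ joined (toℕ ℓ) (part x) (part y)
  edge-in-layer ℓ {x} {y} lx ly px≢py =
    trans (edge-by-layer x y (trans lx (sym ly)) px≢py) (cong (λ l → joined l (part x) (part y)) lx)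

  DPattern : Layer → Fin m → Fin m → Fin m → Set
  DPattern ℓ p q r = ¬ p ≡ q × ¬ p ≡ r × ¬ q ≡ r ×
    joined (toℕ ℓ) p q ≡ true × joined (toℕ ℓ) p r ≡ true × joined (toℕ ℓ) q r ≡ false

  DPattern? : ∀ ℓ p q r → Dec (DPattern ℓ p q r)
  DPattern? ℓ p q r = ¬? (p FP.≟ q) ×-dec ¬? (p FP.≟ r) ×-dec ¬? (q FP.≟ r) ×-dec
    (joined (toℕ ℓ) p q BP.≟ true) ×-dec (joined (toℕ ℓ) p r BP.≟ true) ×-dec
    (joined (toℕ ℓ) q r BP.≟ false)

  DPattern-sequence⇒D : ∀ {ℓ p q r} → DPattern ℓ p q r →
    ∀ u v w → isSeq (A ℓ p) (A ℓ q) (A ℓ r) u v w ≡ true → isD G u v w ≡ true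
  DPattern-sequence⇒D {ℓ} {p} {q} {r} (p≢q , p≢r , q≢r , jpq , jpr , jqr) u v w seq
    with isSeq⁻ seq
  ... | u∈ , v∈ , w∈ , u<v , v<w
    with ∈⟦⟧⁻ (InLayer? ℓ p) u∈ | ∈⟦⟧⁻ (InLayer? ℓ q) v∈ | ∈⟦⟧⁻ (InLayer? ℓ r) w∈
  ... | lu , refl | lv , refl | lw , refl = isD⁺ G u<v v<w
    (trans (edge-in-layer ℓ lu lv p≢q) jpq)
    (trans (edge-in-layer ℓ lu lw p≢r) jpr)
    (trans (edge-in-layer ℓ lv lw q≢r) jqr)

  #hittingSets : ℕ
  #hittingSets = suc (m ℕ.* m) ℕ.* (m ℕ.* (m ℕ.* m))

  1≤m : 1 ≤ m
  1≤m = ℕP.≤-trans (s≤s z≤n) 2≤m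

  K : ℚ
  K = ℕ→ℚ #hittingSets

  instance
    K-positive : ℚ.Positive K
    K-positive = ℚ.positive (ℕ→ℚ-pos #hittingSets (ℕP.*-mono-≤ {1} {suc (m ℕ.* m)} (s≤s z≤n) 1≤m³))
      where 1≤m³ = ℕP.*-mono-≤ 1≤m (ℕP.*-mono-≤ 1≤m 1≤m)

    K-nonZero : ℚ.NonZero K
    K-nonZero = ℚP.pos⇒nonZero K

  ε : ℚ
  ε = γ * ℚ.1/ K

  0<ε : 0ℚ <ℚ ε
  0<ε = ℚP.positive⁻¹ ε {{ℚP.pos*pos⇒pos γ {{ℚ.positive 0<γ}} (ℚ.1/ K) {{ℚP.1/pos⇒pos K}}}}

  K³≤64m¹⁵ : K ^ℚ 3 ≤ℚ ℕ→ℚ 64 * ℕ→ℚ (m ℕ.^ 15)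
  K³≤64m¹⁵ = subst₂ _≤ℚ_ (ℕ→ℚ-^ #hittingSets 3) (ℕ→ℚ-* 64 (m ℕ.^ 15))
    (ℕ→ℚ-mono (#hittingSets³≤64m¹⁵ m 1≤m))

  #sequences≤ : ∀ {ℓ p q r} → DPattern ℓ p q r →
    ℕ→ℚ (count3 (isSeq (A ℓ p) (A ℓ q) (A ℓ r))) ≤ℚ c₃ * (ε ^ℚ 3) * (ℕ→ℚ n ^ℚ 3)
  #sequences≤ shape = ℚP.≤-trans
    (ℕ→ℚ-mono (count3-mono _ _ (DPattern-sequence⇒D shape)))
    (rescaled-count-bound {K = K} (ℚP.<⇒≤ 0<c₃) (ℚP.<⇒≤ 0<γ) γ≤1 (ℕ→ℚ-nonNeg n) (ℕ→ℚ-nonNeg (numD G))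
      (ℚP.<⇒≤ (ℚP.positive⁻¹ (ℚ.1/ K) {{ℚP.1/pos⇒pos K}})) (ℚP.*-inverseʳ K) K³≤64m¹⁵ few-Ds)

  0≤εn : 0ℚ ≤ℚ ε * ℕ→ℚ n
  0≤εn = *-nonNeg (ℚP.<⇒≤ 0<ε) (ℕ→ℚ-nonNeg n)

  HittingSet : Layer → Fin m → Fin m → Fin m → Set
  HittingSet ℓ p q r = Σ (Subset n) λ H →
    ℕ→ℚ ∣ H ∣ ≤ℚ ε * ℕ→ℚ n × (DPattern ℓ p q r → Hits H (A ℓ p) (A ℓ q) (A ℓ r))

  hittingSet-by : ∀ ℓ p q r → Dec (DPattern ℓ p q r) → HittingSet ℓ p q r
  hittingSet-by ℓ p q r (yes shape@(p≢q , p≢r , q≢r , _)) =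
    let H , H-size , H-hits = c₃-property n (A ℓ p) (A ℓ q) (A ℓ r)
          (A-disjoint ℓ p≢q) (A-disjoint ℓ p≢r) (A-disjoint ℓ q≢r) ε 0<ε (#sequences≤ shape)
    in H , H-size , const H-hits
  hittingSet-by ℓ p q r (no ¬shape) =
    ⊥ , subst (λ k → ℕ→ℚ k ≤ℚ ε * ℕ→ℚ n) (sym (SP.∣⊥∣≡0 n)) 0≤εn , ⊥-elim ∘ ¬shape

  opaque
    hittingSet : ∀ ℓ p q r → HittingSet ℓ p q r
    hittingSet ℓ p q r = hittingSet-by ℓ p q r (DPattern? ℓ p q r)

  Index : Set
  Index = Layer × Fin m × Fin m × Fin m

  encode : Index → Fin #hittingSets
  encode (ℓ , p , q , r) = Fin.combine ℓ (Fin.combine p (Fin.combine q r))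

  decode : Fin #hittingSets → Index
  decode = map₂ (map₂ (Fin.remQuot m) ∘ Fin.remQuot (m ℕ.* m)) ∘ Fin.remQuot (m ℕ.* (m ℕ.* m))

  decode-encode : ∀ ι → decode (encode ι) ≡ ι
  decode-encode (ℓ , p , q , r) =
    trans (cong (map₂ (map₂ (Fin.remQuot m) ∘ Fin.remQuot (m ℕ.* m))) (FP.remQuot-combine ℓ _))
      (cong (ℓ ,_) (trans (cong (map₂ (Fin.remQuot m)) (FP.remQuot-combine p _))
        (cong (p ,_) (FP.remQuot-combine q r))))

  H : Index → Subset n
  H (ℓ , p , q , r) = proj₁ (hittingSet ℓ p q r)

  H-size : ∀ ι → ℕ→ℚ ∣ H ι ∣ ≤ℚ ε * ℕ→ℚ n
  H-size (ℓ , p , q , r) = proj₁ (proj₂ (hittingSet ℓ p q r))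

  S : Subset n
  S = ⋃ᶠ (H ∘ decode)

  H⊆S : ∀ ι {x} → x ∈ H ι → x ∈ S
  H⊆S ι x∈ = ∈⋃ᶠ (H ∘ decode) (encode ι) (subst (λ ι′ → _ ∈ H ι′) (sym (decode-encode ι)) x∈)

  ∣S∣≤γn : ℕ→ℚ ∣ S ∣ ≤ℚ γ * ℕ→ℚ n
  ∣S∣≤γn = begin
    ℕ→ℚ ∣ S ∣                    ≤⟨ ∣⋃ᶠ∣≤ (H ∘ decode) (H-size ∘ decode) ⟩
    K * ((γ * ℚ.1/ K) * ℕ→ℚ n)   ≡⟨ solve 4 (λ K r g N → K :* ((g :* r) :* N) := (K :* r) :* (g :* N))
                                          refl K (ℚ.1/ K) γ (ℕ→ℚ n) ⟩
    (K * ℚ.1/ K) * (γ * ℕ→ℚ n)   ≡⟨ cong (_* (γ * ℕ→ℚ n)) (ℚP.*-inverseʳ K) ⟩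
    1ℚ * (γ * ℕ→ℚ n)             ≡⟨ ℚP.*-identityˡ _ ⟩
    γ * ℕ→ℚ n                    ∎
    where
    open ℚP.≤-Reasoning
    open import Data.Rational.Solver using (module +-*-Solver)
    open +-*-Solver

  H-hits : ∀ ℓ p q r → DPattern ℓ p q r → Hits (H (ℓ , p , q , r)) (A ℓ p) (A ℓ q) (A ℓ r)
  H-hits ℓ p q r = proj₂ (proj₂ (hittingSet ℓ p q r))

  Fresh : Layer → Fin m → Fin n → Set
  Fresh ℓ p u = u ∉ S × InLayer ℓ p u

  Fresh? : ∀ ℓ p u → Dec (Fresh ℓ p u)
  Fresh? ℓ p u = ¬? (u SP.∈? S) ×-dec InLayer? ℓ p u

  firstFresh : Layer → Fin m → ℕ
  firstFresh ℓ p with least? (Fresh? ℓ p)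
  ... | inj₁ (g , _) = toℕ g
  ... | inj₂ _ = n

  firstFresh-spec : ∀ ℓ p y → Fresh ℓ p y →
    ∃ λ g → Fresh ℓ p g × toℕ g ≤ toℕ y × firstFresh ℓ p ≡ toℕ g
  firstFresh-spec ℓ p y fresh with least? (Fresh? ℓ p)
  ... | inj₁ (g , fresh-g , g≤) = g , fresh-g , g≤ y fresh , refl
  ... | inj₂ none = ⊥-elim (none y fresh)

  cut : Fin (m ℕ.* m ℕ.+ suc (m ℕ.* m) ℕ.* m) → ℕ
  cut = [ breakpoint , uncurry firstFresh ∘ Fin.remQuot m ]′ ∘ Fin.splitAt (m ℕ.* m)

  cut-breakpoint : ∀ q → cut (q Fin.↑ˡ _) ≡ breakpoint q
  cut-breakpoint q = cong [ breakpoint , _ ]′ (FP.splitAt-↑ˡ (m ℕ.* m) q _)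

  cut-firstFresh : ∀ ℓ p → cut (m ℕ.* m Fin.↑ʳ Fin.combine ℓ p) ≡ firstFresh ℓ p
  cut-firstFresh ℓ p =
    trans (cong [ breakpoint , uncurry firstFresh ∘ Fin.remQuot m ]′ (FP.splitAt-↑ʳ (m ℕ.* m) _ _))
          (cong (uncurry firstFresh) (FP.remQuot-combine ℓ p))

  open IntervalPartition (intervalPartition S cut)

  uncut-by : ∀ {j x y} → x ∈ I j → y ∈ I j → ∀ {c} q → cut q ≡ c → c ≤ toℕ x → c ≤ toℕ y
  uncut-by {j} {x} {y} x∈ y∈ q refl = uncut j x y x∈ y∈ q

  same-layer : ∀ {j x y} → x ∈ I j → y ∈ I j → layer x ≡ layer y
  same-layer x∈ y∈ = #cuts≤-cong breakpoint
    (λ q → uncut-by x∈ y∈ (q Fin.↑ˡ _) (cut-breakpoint q))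
    (λ q → uncut-by y∈ x∈ (q Fin.↑ˡ _) (cut-breakpoint q))

  uniform : ∀ j → PartwiseUniform G part (I j)
  uniform j x y x′ y′ x∈ y∈ x′∈ y′∈ px≡px′ py≡py′ px≢py =
    trans (edge-by-layer x y (same-layer x∈ y∈) px≢py)
      (trans (cong₂ (λ l (pp : Fin m × Fin m) → joined l (proj₁ pp) (proj₂ pp))
               (same-layer x∈ x′∈) (cong₂ _,_ px≡px′ py≡py′))
        (sym (edge-by-layer x′ y′ (same-layer x′∈ y′∈)
          (λ px′≡py′ → px≢py (trans px≡px′ (trans px′≡py′ (sym py≡py′)))))))

  -- The first fresh vertex g of y's part and layer precedes every vertex of another part in y's
  -- interval, since its cut lies at or before y; so (g, u, w) would be a D-pattern sequence missed by S.
  module Apex {j y} (y∈ : y ∈ I j) where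

    ℓ : Layer
    ℓ = layerᶠ y

    in-ℓ : ∀ {w} → w ∈ I j → layer w ≡ toℕ ℓ
    in-ℓ w∈ = trans (same-layer w∈ y∈) (sym (toℕ-layerᶠ y))

    first : ∃ λ g → Fresh ℓ (part y) g × toℕ g ≤ toℕ y × firstFresh ℓ (part y) ≡ toℕ g
    first = firstFresh-spec ℓ (part y) y (avoids j y y∈ , in-ℓ y∈ , refl)

    g : Fin n
    g = proj₁ first

    g-fresh : Fresh ℓ (part y) g
    g-fresh = proj₁ (proj₂ first)

    g<other-parts : ∀ {w} → w ∈ I j → ¬ part y ≡ part w → toℕ g < toℕ w
    g<other-parts w∈ py≢pw = ℕP.≤∧≢⇒<
      (uncut-by y∈ w∈ (m ℕ.* m Fin.↑ʳ Fin.combine ℓ (part y))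
        (trans (cut-firstFresh ℓ (part y)) (proj₂ (proj₂ (proj₂ first)))) (proj₁ (proj₂ (proj₂ first))))
      (λ g≡w → py≢pw (trans (sym (proj₂ (proj₂ g-fresh))) (cong part (FP.toℕ-injective g≡w))))

    no-D-pattern : ∀ {u w} → u ∈ I j → w ∈ I j → toℕ u < toℕ w → ¬ DPattern ℓ (part y) (part u) (part w)
    no-D-pattern {u} {w} u∈ w∈ u<w shape@(py≢pu , _ , _) =
      [ proj₁ g-fresh ∘ H⊆S ι , [ avoids j u u∈ ∘ H⊆S ι , avoids j w w∈ ∘ H⊆S ι ]′ ]′
        (H-hits ℓ (part y) (part u) (part w) shape g u w
          (isSeq⁺ (∈⟦⟧⁺ (InLayer? ℓ (part y)) (proj₂ g-fresh)) (∈⟦⟧⁺ (InLayer? ℓ (part u)) (in-ℓ u∈ , refl))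
                  (∈⟦⟧⁺ (InLayer? ℓ (part w)) (in-ℓ w∈ , refl)) (g<other-parts u∈ py≢pu) u<w))
      where ι = ℓ , part y , part u , part w

  no-P₃ : ∀ j → NoRainbowInducedP₃ G part (I j)
  no-P₃ j x y z x∈ y∈ z∈ px≢py py≢pz px≢pz exy eyz exz = by-order (ℕP.<-cmp (toℕ x) (toℕ z))
    where
    open Apex y∈
    joined-yx : joined (toℕ ℓ) (part y) (part x) ≡ true
    joined-yx = trans (sym (edge-in-layer ℓ (in-ℓ y∈) (in-ℓ x∈) (px≢py ∘ sym))) (trans (E-sym G y x) exy)
    joined-yz : joined (toℕ ℓ) (part y) (part z) ≡ true
    joined-yz = trans (sym (edge-in-layer ℓ (in-ℓ y∈) (in-ℓ z∈) py≢pz)) eyz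
    joined-xz : joined (toℕ ℓ) (part x) (part z) ≡ false
    joined-xz = trans (sym (edge-in-layer ℓ (in-ℓ x∈) (in-ℓ z∈) px≢pz)) exz
    joined-zx : joined (toℕ ℓ) (part z) (part x) ≡ false
    joined-zx = trans (sym (edge-in-layer ℓ (in-ℓ z∈) (in-ℓ x∈) (px≢pz ∘ sym))) (trans (E-sym G z x) exz)
    by-order : ¬ Tri (toℕ x < toℕ z) (toℕ x ≡ toℕ z) (toℕ z < toℕ x)
    by-order (tri< x<z _ _) = no-D-pattern x∈ z∈ x<z
      (px≢py ∘ sym , py≢pz , px≢pz , joined-yx , joined-yz , joined-xz)
    by-order (tri> _ _ z<x) = no-D-pattern z∈ x∈ z<x
      (py≢pz , px≢py ∘ sym , px≢pz ∘ sym , joined-yz , joined-yx , joined-zx)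
    by-order (tri≈ _ x≡z _) = px≢pz (cong part (FP.toℕ-injective x≡z))

  decomposition : IntervalCliqueDecomposition G part γ
  decomposition = S , ∣S∣≤γn , t , I , ℕP.≤-trans t≤1+k (#intervals≤2m³ m 2≤m) ,
    interval , nonempty , disjoint , covers ,
    λ j → disjointCliques G part parts-cliques (I j) (uniform j) (no-P₃ j)

everything-deleted : ∀ {n m} (G : OGraph n) (part : Fin n → Fin m) {γ} → 1ℚ ≤ℚ γ →
  IntervalCliqueDecomposition G part γ
everything-deleted {n} G part {γ} 1≤γ =
  ⊤ , ∣⊤∣≤γn , 0 , (λ ()) , z≤n , (λ ()) , (λ ()) , (λ ()) , (λ x x∉⊤ → ⊥-elim (x∉⊤ SP.∈⊤)) , (λ ())
  where
  ∣⊤∣≤γn : ℕ→ℚ ∣ ⊤ {n} ∣ ≤ℚ γ * ℕ→ℚ n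
  ∣⊤∣≤γn rewrite SP.∣⊤∣≡n n = ℚP.≤-trans (ℚP.≤-reflexive (sym (ℚP.*-identityˡ (ℕ→ℚ n))))
    (ℚP.*-monoʳ-≤-nonNeg (ℕ→ℚ n) {{ℚ.nonNegative (ℕ→ℚ-nonNeg n)}} 1≤γ)

at-most-one-interval : ∀ {t m} → t ≤ 1 → (Fin t → Fin m) → t ≤ 2 ℕ.* m ℕ.^ 3
at-most-one-interval z≤n _ = z≤n
at-most-one-interval {m = zero} (s≤s z≤n) f with f Fin.zero
... | ()
at-most-one-interval {m = suc m} (s≤s z≤n) _ = s≤s z≤n

single-part : ∀ {n m} (G : OGraph n) (part : Fin n → Fin m) →
  (∀ i → IsClique G (λ x → part x ≡ i)) → m < 2 → ∀ {γ} → 0ℚ <ℚ γ →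
  IntervalCliqueDecomposition G part γ
single-part {n} {m} G part parts-cliques m<2 {γ} 0<γ =
  ⊥ , ∣⊥∣≤γn , t , I , at-most-one-interval t≤1+k (part ∘ proj₁ ∘ nonempty) ,
  interval , nonempty , disjoint , covers ,
  λ j → disjointCliques G part parts-cliques (I j)
    (λ _ _ _ _ _ _ _ _ _ _ px≢py → ⊥-elim (px≢py (one-part _ _)))
    (λ _ _ _ _ _ _ px≢py _ _ _ _ _ → px≢py (one-part _ _))
  where
  open IntervalPartition (intervalPartition ⊥ {0} (λ ()))
  ∣⊥∣≤γn : ℕ→ℚ ∣ ⊥ {n} ∣ ≤ℚ γ * ℕ→ℚ n
  ∣⊥∣≤γn rewrite SP.∣⊥∣≡0 n = *-nonNeg (ℚP.<⇒≤ 0<γ) (ℕ→ℚ-nonNeg n)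
  toℕ≡0 : ∀ (i : Fin m) → toℕ i ≡ 0
  toℕ≡0 i = ℕP.n<1⇒n≡0 (ℕP.<-≤-trans (FP.toℕ<n i) (ℕP.≤-pred m<2))
  one-part : ∀ (i j : Fin m) → i ≡ j
  one-part i j = FP.toℕ-injective (trans (toℕ≡0 i) (sym (toℕ≡0 j)))

lemma2p9 :
    ∀ (c₃ : ℚ) → 0ℚ <ℚ c₃ → C3Property c₃ →
    ∀ (n m : ℕ) (G : OGraph n) (part : Fin n → Fin m) →
    (∀ i → IsClique G (λ x → part x ≡ i)) →
    (∀ i j → i Fin.< j → ∀ u v w →
      (part u ≡ i ⊎ part u ≡ j) → (part v ≡ i ⊎ part v ≡ j) →
      (part w ≡ i ⊎ part w ≡ j) → isD G u v w ≡ false) →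
    ∀ (γ : ℚ) → 0ℚ <ℚ γ →
    ℕ→ℚ (numD G) * ℕ→ℚ (m ℕ.^ 15)
      ≤ℚ (c₃ * (+ 1 / 64)) * (γ ^ℚ 6) * (ℕ→ℚ n ^ℚ 3) →
    Σ (Subset n) λ S →
      (ℕ→ℚ ∣ S ∣ ≤ℚ γ * ℕ→ℚ n) ×
      Σ ℕ λ t → Σ (Fin t → Subset n) λ I →
        (t ℕ.≤ 2 ℕ.* (m ℕ.^ 3)) ×
        (∀ j → IsInterval (Data.Fin.Subset.∁ S) (I j)) ×
        (∀ j → ∃ λ x → x ∈ I j) ×
        (∀ j j′ x → x ∈ I j → x ∈ I j′ → j ≡ j′) ×
        (∀ x → x ∉ S → ∃ λ j → x ∈ I j) ×
        (∀ j → DUCliquesOfForm G part (I j))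
lemma2p9 c₃ 0<c₃ c₃-property n m G part parts-cliques pairs-D-free γ 0<γ few-Ds
  with 1ℚ ℚP.≤? γ | 2 ℕ.≤? m
... | yes 1≤γ | _ = everything-deleted G part 1≤γ
... | no _ | no m≱2 = single-part G part parts-cliques (ℕP.≰⇒> m≱2) 0<γ
... | no 1≰γ | yes 2≤m = Construction.decomposition c₃ 0<c₃ c₃-property 2≤m G part parts-cliques
      pairs-D-free γ 0<γ (ℚP.<⇒≤ (ℚP.≰⇒> 1≰γ)) few-Ds
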